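{- In the Ctrie algorithm described in the context, if an inode $in$ is either a null-inode or a tomb-inode at some time $t_0$, then for all $t>t_0$ the field $in.main$ is not written.
   Context: A Ctrie is a concurrent shared-memory map accessed by threads using atomic reads and single-word compare-and-swap CAS$(x,e,n)$ (atomically: if $x$ holds $e$, write $n$ and succeed; else fail). Node types: an inode has one mutable field $main$, holding $null$, a cnode or an snode; a cnode holds an integer bitmap and an array of references to inodes or snodes; an snode holds a key, a value and a boolean tomb flag (tombed snode if set). A null-inode is an inode whose $main$ is $null$; a tomb-inode is an inode whose $main$ is a tombed snode. In the algorithm (operations insert, lookup, remove and their helpers iinsert, ilookup, iremove, clean, tombCompress, contractParent), after an inode becomes reachable, its $main$ field is only ever written by CAS instructions whose expected value is a cnode previously read from that same $main$ field: in iinsert and iremove (replacing a cnode by an updated copy or, in iremove, by $null$), in clean (replacing a cnode $m$ by its compression), in tombCompress (replacing a cnode $m$ by its weak tombing), and in contractParent (replacing a parent's cnode by a copy with one entry removed or resurrected). No other writes to $main$ occur; new inodes are created with their $main$ already set. -}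

module Defs where

open import Data.Nat using (ℕ; zero; suc; _≤_)
open import Data.Bool using (Bool; true; false)
open import Data.Maybe using (Maybe; just; nothing)
open import Data.Product using (Σ; ∃; _×_; _,_)
open import Data.Sum using (_⊎_)
open import Relation.Nullary using (yes; no)
open import Relation.Binary.Definitions using (DecidableEquality)
open import Relation.Binary.PropositionalEquality using (_≡_)

-- Kinds of heap objects that may be stored in an inode's main field.
-- A cnode (bitmap + array) or an snode (key, value, tomb flag).
data Kind : Set where
  cnodeK : Kind
  snodeK : (tomb : Bool) → Kind

record Heap : Set₁ where
  field
    Inode   : Set
    Node    : Set
    _≟I_    : DecidableEquality Inode
    _≟N_    : DecidableEquality (Maybe Node)   -- CAS compares references (or null)
    kind    : Node → Kind

module _ (H : Heap) where
  open Heap H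

  Main : Set
  Main = Maybe Node

  Mem : Set
  Mem = Inode → Main

  -- Atomic steps of an execution (one per time step, interleaving all threads)
  -- as they concern main fields: a CAS(in.main, e, n), or any other step
  -- (reads, allocations, writes to other fields) which leaves main fields unchanged.
  data Event : Set where
    cas   : (i : Inode) (e n : Main) → Event
    other : Event

  stepMem : Event → Mem → Mem
  stepMem (cas j e n) m i with j ≟I i | m i ≟N e
  ... | yes _ | yes _ = n
  ... | yes _ | no  _ = m i
  ... | no  _ | _     = m i
  stepMem other m i = m i

  -- state m0 ev t = memory at time t (before the step ev t is executed)
  state : Mem → (ℕ → Event) → ℕ → Mem
  state m0 ev zero    = m0
  state m0 ev (suc t) = stepMem (ev t) (state m0 ev t)

  WrittenAt : Mem → (ℕ → Event) → ℕ → Inode → Set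
  WrittenAt m0 ev t i =
    Σ Main λ e → Σ Main λ n → (ev t ≡ cas i e n) × (state m0 ev t i ≡ e)

  -- Standing discipline of the Ctrie algorithm: every CAS on a main field
  -- has as expected value a cnode previously read from that same main field.
  CasDiscipline : Mem → (ℕ → Event) → Set
  CasDiscipline m0 ev =
    ∀ t i e n → ev t ≡ cas i e n →
      Σ Node λ c → (e ≡ just c) × (kind c ≡ cnodeK)
        × Σ ℕ λ t' → (t' ≤ t) × (state m0 ev t' i ≡ just c)

  NullOrTomb : Main → Set
  NullOrTomb v = (v ≡ nothing) ⊎ Σ Node λ s → (v ≡ just s) × (kind s ≡ snodeK true)

-- Every CAS on a main field expects a cnode, while a null- or tomb-inode holds
-- none; so a CAS on such an inode fails and leaves main unchanged. Being
-- null-or-tomb is thus invariant from t0 on, and at each later step it rules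
-- out a successful CAS.
module Submission where

open import Defs
open import Data.Nat using (ℕ; _≤_; suc)
open import Data.Nat.Base using (_≤′_; ≤′-refl; ≤′-step)
open import Data.Nat.Properties using (≤⇒≤′)
open import Data.Maybe using (just)
open import Data.Product using (_,_)
open import Data.Sum using (inj₁; inj₂)
open import Data.Empty using (⊥-elim)
open import Relation.Nullary using (¬_; yes; no)
open import Relation.Binary.PropositionalEquality using (_≡_; _≢_; refl; trans; sym)

invariant-from : (P : ℕ → Set) → (∀ t → P t → P (suc t)) →
  ∀ {t0 t} → t0 ≤ t → P t0 → P t
invariant-from P step t0≤t = go (≤⇒≤′ t0≤t)
  where
  go : ∀ {t0 t} → t0 ≤′ t → P t0 → P t
  go ≤′-refl        p = p
  go (≤′-step t0≤t) p = step _ (go t0≤t p)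

module _ (H : Heap) where
  open Heap H

  nullOrTomb⇒¬cnode : ∀ {v} c → NullOrTomb H v → v ≡ just c → kind c ≢ cnodeK
  nullOrTomb⇒¬cnode c (inj₁ refl)            ()
  nullOrTomb⇒¬cnode c (inj₂ (s , refl , ks)) refl kc with trans (sym ks) kc
  ... | ()

  ¬WrittenAt⇒unchanged : ∀ m0 ev t i → ¬ WrittenAt H m0 ev t i →
    state H m0 ev (suc t) i ≡ state H m0 ev t i
  ¬WrittenAt⇒unchanged m0 ev t i ¬written with ev t
  ... | other = refl
  ... | cas j e n with j ≟I i | state H m0 ev t i ≟N e
  ...   | yes refl | yes st = ⊥-elim (¬written (e , n , refl , st))
  ...   | yes _    | no _   = refl
  ...   | no _     | _      = refl

  module _ (m0 : Mem H) (ev : ℕ → Event H) (discipline : CasDiscipline H m0 ev)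
           (i : Inode) where

    nullOrTomb⇒¬WrittenAt : ∀ t → NullOrTomb H (state H m0 ev t i) →
      ¬ WrittenAt H m0 ev t i
    nullOrTomb⇒¬WrittenAt t nt (e , n , ev-t , st) with discipline t i e n ev-t
    ... | c , refl , kc , _ = nullOrTomb⇒¬cnode c nt st kc

    nullOrTomb-step : ∀ t → NullOrTomb H (state H m0 ev t i) →
      NullOrTomb H (state H m0 ev (suc t) i)
    nullOrTomb-step t nt
      rewrite ¬WrittenAt⇒unchanged m0 ev t i (nullOrTomb⇒¬WrittenAt t nt) = nt

lemma1 : (H : Heap) (m0 : Mem H) (ev : ℕ → Event H) →
    CasDiscipline H m0 ev →
    (i : Heap.Inode H) (t0 : ℕ) → NullOrTomb H (state H m0 ev t0 i) →
    (t : ℕ) → t0 ≤ t → ¬ WrittenAt H m0 ev t i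
lemma1 H m0 ev discipline i t0 nt t t0≤t =
  nullOrTomb⇒¬WrittenAt H m0 ev discipline i t
    (invariant-from (λ s → NullOrTomb H (state H m0 ev s i))
       (nullOrTomb-step H m0 ev discipline i) t0≤t nt)
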